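{- For every $n\in\mathbb{N}$ let $$N_n(x)=\frac{1}{4n+2}\sum_{k=1}^{n-1}k(n-k)\binom{2n+2}{2k+1}x^k .$$ Then for each $n\in\mathbb{N}$ the polynomial $N_n(x)$ is log-concave.
   Context: A polynomial $f(x)=\sum_{k=0}^n f_kx^k$ is log-concave if $f_k^2\ge f_{k-1}f_{k+1}$ for all $1\le k\le n-1$. -}

module Defs where

open import Data.Nat as ℕ using (ℕ; zero; suc; _∸_; _<_)
open import Data.Nat.Combinatorics using (_C_)
open import Data.Rational using (ℚ; _≤_; _*_; _/_)
import Data.Rational as ℚ
open import Relation.Nullary.Decidable using (⌊_⌋)
open import Data.Bool using (if_then_else_; _∧_)

-- A polynomial f(x) = Σ_{k=0}^{d} f_k x^k is given by its coefficient
-- function f : ℕ → ℚ together with a degree bound d (coefficients with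
-- index > d are zero).
LogConcave : ℕ → (ℕ → ℚ) → Set
LogConcave d f = (k : ℕ) → 1 ℕ.≤ k → k ℕ.≤ d ∸ 1 →
  f (k ∸ 1) * f (suc k) ≤ f k * f k

Ncoeff : ℕ → ℕ → ℚ
Ncoeff n k =
  if ⌊ 1 ℕ.≤? k ⌋ ∧ ⌊ k ℕ.≤? n ∸ 1 ⌋
  then (ℤ.+ (k ℕ.* (n ∸ k) ℕ.* ((2 ℕ.* n ℕ.+ 2) C (2 ℕ.* k ℕ.+ 1)))) / suc (4 ℕ.* n ℕ.+ 1)   -- = 4n+2
  else ℚ.0ℚ
  where import Data.Integer as ℤ

-- Up to the positive factor 1/(4n+2), the k-th coefficient of N_n is the
-- product of the three sequences k, n − k and C(2n+2, 2k+1).  Each of them is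
-- log-concave: the first two trivially, the third because every row of
-- Pascal's triangle is log-concave (by the absorption identity
-- (j+1) C(m,j+1) = (m−j) C(m,j)) and taking every other term of a log-concave
-- sequence without internal zeros preserves log-concavity.  Log-concave
-- sequences of naturals are closed under pointwise products.
module Submission where

open import Defs
open import Data.Nat as ℕ
  using (ℕ; _∸_; zero; suc; _+_; _*_; _≤_; _<_; z≤n; s≤s; z<s; _<?_; _≤?_; _≟_; ≢-nonZero)
open import Data.Nat.Properties
open import Data.Nat.Combinatorics
  using (_C_; nC1≡n; k>n⇒nCk≡0; nCk+nC[k+1]≡[n+1]C[k+1])
open import Data.Nat.Tactic.RingSolver using (solve; solve-∀)
open import Data.List using ([]; _∷_)
open import Data.Product using (_,_)
open import Data.Integer as ℤ using (+_)
import Data.Integer.Properties as ℤ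
open import Data.Rational as ℚ using (_/_; toℚᵘ)
import Data.Rational.Properties as ℚ
open import Data.Rational.Unnormalised as ℚᵘ using (mkℚᵘ; *≤*)
import Data.Rational.Unnormalised.Properties as ℚᵘ
open import Algebra.Properties.CommutativeSemigroup *-commutativeSemigroup
  using (interchange)
open import Relation.Nullary using (yes; no; contradiction)
open import Relation.Binary.PropositionalEquality

IsLogConcave : (ℕ → ℕ) → Set
IsLogConcave f = ∀ j → f j * f (2 + j) ≤ f (1 + j) * f (1 + j)

isLogConcave-* : ∀ {f g} → IsLogConcave f → IsLogConcave g →
                 IsLogConcave (λ j → f j * g j)
isLogConcave-* {f} {g} f-lc g-lc j = begin
  f j * g j * (f (2 + j) * g (2 + j))           ≡⟨ interchange (f j) (g j) (f (2 + j)) (g (2 + j)) ⟩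
  f j * f (2 + j) * (g j * g (2 + j))           ≤⟨ *-mono-≤ (f-lc j) (g-lc j) ⟩
  f (1 + j) * f (1 + j) * (g (1 + j) * g (1 + j)) ≡⟨ interchange (f (1 + j)) (f (1 + j)) (g (1 + j)) (g (1 + j)) ⟩
  f (1 + j) * g (1 + j) * (f (1 + j) * g (1 + j)) ∎
  where open ≤-Reasoning

isLogConcave-id : IsLogConcave (λ j → j)
isLogConcave-id j = begin
  j * (2 + j)             ≤⟨ m≤m+n (j * (2 + j)) 1 ⟩
  j * (2 + j) + 1         ≡⟨ solve (j ∷ []) ⟩
  (1 + j) * (1 + j)       ∎
  where open ≤-Reasoning

isLogConcave-∸ : ∀ n → IsLogConcave (n ∸_)
isLogConcave-∸ zero          zero    = z≤n
isLogConcave-∸ (suc zero)    zero    = z≤n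
isLogConcave-∸ (suc (suc u)) zero    = subst (_≤ suc u * suc u) (*-comm u (2 + u)) (isLogConcave-id u)
isLogConcave-∸ zero          (suc j) = z≤n
isLogConcave-∸ (suc n)       (suc j) = isLogConcave-∸ n j

isLogConcave⇒f[i]f[4+i]≤f[2+i]² : ∀ {f} → IsLogConcave f → (∀ j → f j ≡ 0 → f (suc j) ≡ 0) →
                                  ∀ i → f i * f (4 + i) ≤ f (2 + i) * f (2 + i)
isLogConcave⇒f[i]f[4+i]≤f[2+i]² {f} f-lc zeros-persist i with f (2 + i) ≟ 0
... | yes f[2+i]≡0 =
  subst (_≤ f (2 + i) * f (2 + i))
    (sym (trans (cong (f i *_) (zeros-persist (3 + i) (zeros-persist (2 + i) f[2+i]≡0))) (*-zeroʳ (f i))))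
    z≤n
... | no f[2+i]≢0 =
  *-cancelʳ-≤ (b₀ * b₄) (b₂ * b₂) (b₂ * b₂) {{m*n≢0 b₂ b₂ {{≢-nonZero f[2+i]≢0}} {{≢-nonZero f[2+i]≢0}}}} (begin
    b₀ * b₄ * (b₂ * b₂)   ≡⟨ interchange b₀ b₄ b₂ b₂ ⟩
    (b₀ * b₂) * (b₄ * b₂) ≡⟨ cong (b₀ * b₂ *_) (*-comm b₄ b₂) ⟩
    (b₀ * b₂) * (b₂ * b₄) ≤⟨ *-mono-≤ (f-lc i) (f-lc (2 + i)) ⟩
    (b₁ * b₁) * (b₃ * b₃) ≡⟨ interchange b₁ b₁ b₃ b₃ ⟩
    (b₁ * b₃) * (b₁ * b₃) ≤⟨ *-mono-≤ (f-lc (1 + i)) (f-lc (1 + i)) ⟩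
    b₂ * b₂ * (b₂ * b₂)   ∎)
  where
  open ≤-Reasoning
  b₀ = f i
  b₁ = f (1 + i)
  b₂ = f (2 + i)
  b₃ = f (3 + i)
  b₄ = f (4 + i)

isLogConcave-every-other : ∀ {f} → IsLogConcave f → (∀ j → f j ≡ 0 → f (suc j) ≡ 0) →
                           ∀ c → IsLogConcave (λ k → f (2 * k + c))
isLogConcave-every-other {f} f-lc zeros-persist c k =
  subst₂ (λ a b → f (2 * k + c) * a ≤ b * b)
    (cong f (sym (index₂ k c)))
    (cong f (sym (index₁ k c)))
    (isLogConcave⇒f[i]f[4+i]≤f[2+i]² f-lc zeros-persist (2 * k + c))
  where
  index₁ : ∀ k c → 2 * (1 + k) + c ≡ 2 + (2 * k + c)
  index₁ = solve-∀
  index₂ : ∀ k c → 2 * (2 + k) + c ≡ 4 + (2 * k + c)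
  index₂ = solve-∀

C-pos : ∀ {m j} → j ≤ m → 0 < m C j
C-pos {m}     {zero}  _         = z<s
C-pos {suc m} {suc j} (s≤s j≤m) =
  subst (0 <_) (nCk+nC[k+1]≡[n+1]C[k+1] m j) (≤-trans (C-pos j≤m) (m≤m+n (m C j) (m C suc j)))

C-zeros-persist : ∀ m j → m C j ≡ 0 → m C suc j ≡ 0
C-zeros-persist m j mCj≡0 with j <? m
... | yes j<m = contradiction mCj≡0 (>⇒≢ (C-pos (<⇒≤ j<m)))
... | no  j≮m = k>n⇒nCk≡0 (s≤s (≮⇒≥ j≮m))

C-absorption : ∀ m j → suc j * (m C suc j) + j * (m C j) ≡ m * (m C j)
C-absorption zero    zero    = refl
C-absorption zero    (suc j)
  rewrite k>n⇒nCk≡0 {0} {2 + j} z<s | k>n⇒nCk≡0 {0} {1 + j} z<s | *-zeroʳ j = refl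
C-absorption (suc m) zero    = begin
  1 * (suc m C 1) + 0 ≡⟨ +-identityʳ _ ⟩
  1 * (suc m C 1)     ≡⟨ *-identityˡ _ ⟩
  suc m C 1           ≡⟨ nC1≡n (suc m) ⟩
  suc m               ≡⟨ *-identityʳ (suc m) ⟨
  suc m * 1           ∎
  where open ≡-Reasoning
C-absorption (suc m) (suc j) = begin
  (2 + j) * (suc m C (2 + j)) + (1 + j) * (suc m C (1 + j))
    ≡⟨ cong₂ (λ a b → (2 + j) * a + (1 + j) * b)
         (nCk+nC[k+1]≡[n+1]C[k+1] m (suc j)) (nCk+nC[k+1]≡[n+1]C[k+1] m j) ⟨
  (2 + j) * (y + z) + (1 + j) * (x + y)
    ≡⟨ regroup j x y z ⟩
  ((2 + j) * z + (1 + j) * y) + ((1 + j) * y + j * x) + (x + y)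
    ≡⟨ cong₂ (λ a b → a + b + (x + y)) (C-absorption m (suc j)) (C-absorption m j) ⟩
  m * y + m * x + (x + y)
    ≡⟨ collect m x y ⟩
  suc m * (x + y)
    ≡⟨ cong (suc m *_) (nCk+nC[k+1]≡[n+1]C[k+1] m j) ⟩
  suc m * (suc m C suc j) ∎
  where
  open ≡-Reasoning
  x = m C j
  y = m C suc j
  z = m C suc (suc j)
  regroup : ∀ j x y z → (2 + j) * (y + z) + (1 + j) * (x + y)
                      ≡ ((2 + j) * z + (1 + j) * y) + ((1 + j) * y + j * x) + (x + y)
  regroup = solve-∀
  collect : ∀ m x y → m * y + m * x + (x + y) ≡ suc m * (x + y)
  collect = solve-∀

C-ratio : ∀ j t → suc j * ((j + t) C suc j) ≡ t * ((j + t) C j)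
C-ratio j t = +-cancelʳ-≡ (j * ((j + t) C j)) (suc j * ((j + t) C suc j)) (t * ((j + t) C j)) (begin
  suc j * ((j + t) C suc j) + j * ((j + t) C j) ≡⟨ C-absorption (j + t) j ⟩
  (j + t) * ((j + t) C j)                       ≡⟨ *-distribʳ-+ ((j + t) C j) j t ⟩
  j * ((j + t) C j) + t * ((j + t) C j)         ≡⟨ +-comm (j * ((j + t) C j)) (t * ((j + t) C j)) ⟩
  t * ((j + t) C j) + j * ((j + t) C j)         ∎)
  where open ≡-Reasoning

isLogConcave-C : ∀ m → IsLogConcave (m C_)
isLogConcave-C m j with j <? m
... | no j≮m rewrite k>n⇒nCk≡0 {m} {2 + j} (s≤s (≤-trans (≮⇒≥ j≮m) (n≤1+n j))) | *-zeroʳ (m C j) = z≤n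
... | yes j<m with m≤n⇒∃[o]m+o≡n j<m
...   | t , refl = *-cancelʳ-≤ (x * z) (y * y) ((2 + j) * (1 + t)) (begin
  x * z * ((2 + j) * (1 + t))  ≡⟨ rearrange x z (2 + j) (1 + t) ⟩
  ((1 + t) * x) * ((2 + j) * z) ≡⟨ cong₂ _*_ (sym y-from-x) z-from-y ⟩
  ((1 + j) * y) * (t * y)       ≡⟨ interchange (1 + j) y t y ⟩
  ((1 + j) * t) * (y * y)       ≤⟨ *-monoˡ-≤ (y * y) (*-mono-≤ (n≤1+n (1 + j)) (n≤1+n t)) ⟩
  ((2 + j) * (1 + t)) * (y * y) ≡⟨ *-comm _ (y * y) ⟩
  y * y * ((2 + j) * (1 + t))  ∎)
  where
  open ≤-Reasoning
  x = (suc j + t) C j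
  y = (suc j + t) C suc j
  z = (suc j + t) C suc (suc j)
  y-from-x : (1 + j) * y ≡ (1 + t) * x
  y-from-x = subst (λ m → suc j * (m C suc j) ≡ suc t * (m C j)) (+-suc j t) (C-ratio j (suc t))
  z-from-y : (2 + j) * z ≡ t * y
  z-from-y = C-ratio (suc j) t
  rearrange : ∀ x z a b → x * z * (a * b) ≡ (b * x) * (a * z)
  rearrange = solve-∀

Nnumerator : ℕ → ℕ → ℕ
Nnumerator n k = k * (n ∸ k) * ((2 * n + 2) C (2 * k + 1))

isLogConcave-Nnumerator : ∀ n → IsLogConcave (Nnumerator n)
isLogConcave-Nnumerator n =
  isLogConcave-* {λ k → k * (n ∸ k)} {λ k → (2 * n + 2) C (2 * k + 1)}
    (isLogConcave-* {λ k → k} {n ∸_} isLogConcave-id (isLogConcave-∸ n))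
    (isLogConcave-every-other {(2 * n + 2) C_}
      (isLogConcave-C (2 * n + 2)) (C-zeros-persist (2 * n + 2)) 1)

Ncoeff≡Nnumerator/[4n+2] : ∀ n k → Ncoeff n k ≡ (+ Nnumerator n k) / suc (4 * n + 1)
Ncoeff≡Nnumerator/[4n+2] n k with 1 ≤? k | k ≤? n ∸ 1
... | yes _   | yes _ = refl
... | no 1≰k  | _     rewrite n≤0⇒n≡0 (≮⇒≥ 1≰k) = sym (ℚ.0/n≡0 (suc (4 * n + 1)))
... | yes 1≤k | no k≰n-1 = begin
  ℚ.0ℚ                                       ≡⟨ ℚ.0/n≡0 (suc (4 * n + 1)) ⟨
  + 0 / suc (4 * n + 1)                       ≡⟨ cong (λ a → + a / suc (4 * n + 1)) numerator≡0 ⟨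
  (+ Nnumerator n k) / suc (4 * n + 1)        ∎
  where
  open ≡-Reasoning
  n≤k : n ≤ k
  n≤k = ≤-trans (m≤n+m∸n n 1) (≰⇒> k≰n-1)
  numerator≡0 : Nnumerator n k ≡ 0
  numerator≡0 rewrite m≤n⇒m∸n≡0 n≤k | *-zeroʳ k = refl

[a/d][b/d]≤[c/d]² : ∀ a b c d → a * b ≤ c * c →
  (+ a / suc d) ℚ.* (+ b / suc d) ℚ.≤ (+ c / suc d) ℚ.* (+ c / suc d)
[a/d][b/d]≤[c/d]² a b c d ab≤c² = ℚ.toℚᵘ-cancel-≤ (begin
  toℚᵘ (a/d ℚ.* b/d)                   ≃⟨ ℚ.toℚᵘ-homo-* a/d b/d ⟩
  toℚᵘ a/d ℚᵘ.* toℚᵘ b/d               ≃⟨ ℚᵘ.*-cong (unnormalise a) (unnormalise b) ⟩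
  mkℚᵘ (+ a) d ℚᵘ.* mkℚᵘ (+ b) d       ≤⟨ numerators-≤ ⟩
  mkℚᵘ (+ c) d ℚᵘ.* mkℚᵘ (+ c) d       ≃⟨ ℚᵘ.*-cong (unnormalise c) (unnormalise c) ⟨
  toℚᵘ c/d ℚᵘ.* toℚᵘ c/d               ≃⟨ ℚ.toℚᵘ-homo-* c/d c/d ⟨
  toℚᵘ (c/d ℚ.* c/d)                   ∎)
  where
  open ℚᵘ.≤-Reasoning
  a/d = + a / suc d
  b/d = + b / suc d
  c/d = + c / suc d
  unnormalise : ∀ x → toℚᵘ (+ x / suc d) ℚᵘ.≃ mkℚᵘ (+ x) d
  unnormalise x = ℚ.toℚᵘ-fromℚᵘ (mkℚᵘ (+ x) d)
  numerators-≤ : mkℚᵘ (+ a) d ℚᵘ.* mkℚᵘ (+ b) d ℚᵘ.≤ mkℚᵘ (+ c) d ℚᵘ.* mkℚᵘ (+ c) d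
  numerators-≤ = *≤* (ℤ.*-monoʳ-≤-nonNeg _ (subst₂ ℤ._≤_ (ℤ.pos-* a b) (ℤ.pos-* c c) (ℤ.+≤+ ab≤c²)))

-- Nnumerator n is log-concave on all of ℕ.
mainTheorem2 : (n : ℕ) → LogConcave (n ∸ 1) (Ncoeff n)
mainTheorem2 n zero    ()
mainTheorem2 n (suc j) _ _ =
  subst₂ ℚ._≤_
    (sym (cong₂ ℚ._*_ (Ncoeff≡Nnumerator/[4n+2] n j) (Ncoeff≡Nnumerator/[4n+2] n (2 + j))))
    (sym (cong (λ x → x ℚ.* x) (Ncoeff≡Nnumerator/[4n+2] n (1 + j))))
    ([a/d][b/d]≤[c/d]² (Nnumerator n j) (Nnumerator n (2 + j)) (Nnumerator n (1 + j)) (4 * n + 1)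
      (isLogConcave-Nnumerator n j))
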